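{- Let $l>1$ be an integer. Let $m_1>m_2>\cdots>m_k\geq 1$ be integers and $a_1,\dots,a_k$ integers with $0\leq a_i\leq l-1$ and $a_1\neq 0$. Then $$\|a_1l^{m_1}+a_2l^{m_2}+\cdots+a_kl^{m_k}\|_l\leq m_1+a_1+a_2+\cdots+a_k-1.$$
   Context: For a positive integer $l$ and $n\in l\mathbb{Z}^+$, the $l$-complexity $\|n\|_l$ is the minimal number of copies of $l$ needed to express $n$ from $l$ using only addition and multiplication (and parentheses). Equivalently, $\|l\|_l=1$ and $\|n\|_l=\min(\|a\|_l+\|b\|_l)$, the minimum over $a,b\in l\mathbb{Z}^+$ with $a+b=n$ or $ab=n$. -}

module Defs where

open import Data.Nat using (ℕ; suc; _+_; _*_; _≤_)
open import Data.Product using (Σ; _×_)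
open import Relation.Binary.PropositionalEquality using (_≡_)

-- Arithmetic expressions built from copies of a single constant l
-- using only addition and multiplication (parentheses = tree structure).
data Expr : Set where
  lit : Expr
  add : Expr → Expr → Expr
  mul : Expr → Expr → Expr

eval : ℕ → Expr → ℕ
eval l lit       = l
eval l (add e f) = eval l e + eval l f
eval l (mul e f) = eval l e * eval l f

copies : Expr → ℕ
copies lit       = 1
copies (add e f) = copies e + copies f
copies (mul e f) = copies e + copies f

-- ‖ n ‖ l ≤ c : the l-complexity of n (minimal number of copies of l
-- needed to express n) is at most c, i.e. some expression of n uses
-- at most c copies of l.
‖_‖_≤_ : ℕ → ℕ → ℕ → Set
‖ n ‖ l ≤ c = Σ Expr (λ e → (eval l e ≡ n) × (copies e ≤ c))

{-# OPTIONS --safe #-}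
module Submission where

-- Horner's scheme: a₁l^m₁ + ⋯ + a_kl^m_k
--   = ((a₁l · l^(m₁-m₂-1) + a₂l) · l^(m₂-m₃-1) + ⋯ + a_kl) · l^(m_k-1),
-- where each aᵢl = l + ⋯ + l costs aᵢ copies of l and each factor l one more;
-- the exponents telescope to m₁ - 1.

open import Defs
open import Data.Nat using (ℕ; suc; zero; _+_; _*_; _^_; _∸_; _≤_; _<_; _>_; s≤s; z≤n)
open import Data.Nat.Properties using (≤-refl; ≤-pred; +-mono-≤; +-assoc; +-identityʳ; *-assoc; *-identityʳ; ^-distribˡ-+-*; m≤n⇒∃[o]m+o≡n)
open import Data.Nat.Tactic.RingSolver using (solve-∀)
open import Data.Fin using (Fin; zero; suc) renaming (_<_ to _<ᶠ_)
open import Data.Vec using (sum; tabulate)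
open import Function using (_∘_)
open import Data.Empty using (⊥-elim)
open import Data.Product using (_,_)
open import Relation.Binary.PropositionalEquality using (_≢_; _≡_; refl; sym; trans; cong; module ≡-Reasoning)

‖l‖≤1 : ∀ l → ‖ l ‖ l ≤ 1
‖l‖≤1 l = lit , refl , ≤-refl

‖x+y‖≤c+d : ∀ {l x y c d} → ‖ x ‖ l ≤ c → ‖ y ‖ l ≤ d → ‖ x + y ‖ l ≤ (c + d)
‖x+y‖≤c+d (e , refl , e≤c) (f , refl , f≤d) = add e f , refl , +-mono-≤ e≤c f≤d

‖x*y‖≤c+d : ∀ {l x y c d} → ‖ x ‖ l ≤ c → ‖ y ‖ l ≤ d → ‖ x * y ‖ l ≤ (c + d)
‖x*y‖≤c+d (e , refl , e≤c) (f , refl , f≤d) = mul e f , refl , +-mono-≤ e≤c f≤d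

‖‖≤-cong : ∀ {l x y c d} → x ≡ y → c ≡ d → ‖ x ‖ l ≤ c → ‖ y ‖ l ≤ d
‖‖≤-cong refl refl x≤c = x≤c

‖x*l^n‖≤c+n : ∀ {l x c} n → ‖ x ‖ l ≤ c → ‖ x * l ^ n ‖ l ≤ (c + n)
‖x*l^n‖≤c+n {l} {x} {c} zero ‖x‖≤c =
  ‖‖≤-cong (sym (*-identityʳ x)) (sym (+-identityʳ c)) ‖x‖≤c
‖x*l^n‖≤c+n {l} {x} {c} (suc n) ‖x‖≤c =
  ‖‖≤-cong (reassoc x l (l ^ n)) (+1≡+suc c n) (‖x*y‖≤c+d (‖x*l^n‖≤c+n n ‖x‖≤c) (‖l‖≤1 l))
  where
  reassoc : ∀ x l y → x * y * l ≡ x * (l * y)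
  reassoc = solve-∀
  +1≡+suc : ∀ c n → c + n + 1 ≡ c + suc n
  +1≡+suc = solve-∀

‖[1+a]*l‖≤1+a : ∀ {l} a → ‖ suc a * l ‖ l ≤ suc a
‖[1+a]*l‖≤1+a {l} zero    = ‖‖≤-cong (sym (+-identityʳ l)) refl (‖l‖≤1 l)
‖[1+a]*l‖≤1+a {l} (suc a) = ‖x+y‖≤c+d (‖l‖≤1 l) (‖[1+a]*l‖≤1+a a)

Decreasing : ∀ {k} → (Fin k → ℕ) → Set
Decreasing m = ∀ i j → i <ᶠ j → m j < m i

Decreasing-tail : ∀ {k} {m : Fin (suc k) → ℕ} → Decreasing m → Decreasing (m ∘ suc)
Decreasing-tail dec i j i<j = dec (suc i) (suc j) (s≤s i<j)

Decreasing⇒tail<head : ∀ {k} {m : Fin (suc k) → ℕ} → Decreasing m → ∀ i → m (suc i) < m zero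
Decreasing⇒tail<head dec i = dec zero (suc i) (s≤s z≤n)

expansion : ∀ {k} → ℕ → (a m : Fin k → ℕ) → ℕ
expansion l a m = sum (tabulate (λ i → a i * l ^ m i))

horner-step : ∀ x l a p d → (x * l ^ suc d + a * l) * l ^ p ≡ x * l ^ (suc p + d) + a * l ^ suc p
horner-step x l a p d = begin
  (x * (l * l ^ d) + a * l) * l ^ p           ≡⟨ distrib x l a (l ^ d) (l ^ p) ⟩
  x * (l * (l ^ p * l ^ d)) + a * (l * l ^ p) ≡⟨ cong (λ y → x * (l * y) + a * (l * l ^ p)) (sym (^-distribˡ-+-* l p d)) ⟩
  x * (l * l ^ (p + d)) + a * (l * l ^ p)     ∎
  where
  open ≡-Reasoning
  distrib : ∀ x l a y z → (x * (l * y) + a * l) * z ≡ x * (l * (z * y)) + a * (l * z)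
  distrib = solve-∀

horner-bound : ∀ {l k c x} (m a : Fin k → ℕ) → Decreasing m → (∀ i → 1 ≤ m i) →
               ∀ M → (∀ i → m i ≤ M) → ‖ x ‖ l ≤ c →
               ‖ x * l ^ M + expansion l a m ‖ l ≤ (c + M + sum (tabulate a))
horner-bound {k = zero} m a _ _ M _ ‖x‖≤c =
  ‖‖≤-cong (sym (+-identityʳ _)) (sym (+-identityʳ _)) (‖x*l^n‖≤c+n M ‖x‖≤c)
horner-bound {l} {suc k} {c} {x} m a dec pos M bound ‖x‖≤c
  with a zero | m zero | pos zero | bound zero | Decreasing⇒tail<head dec
... | zero  | _     | _  | _    | _       =
  horner-bound (m ∘ suc) (a ∘ suc) (Decreasing-tail dec) (pos ∘ suc) M (bound ∘ suc) ‖x‖≤c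
... | suc b | zero  | () | _    | _
... | suc b | suc p | _  | m₀≤M | tail<m₀ with m≤n⇒∃[o]m+o≡n m₀≤M
...   | d , refl = ‖‖≤-cong value cost
          (horner-bound (m ∘ suc) (a ∘ suc) (Decreasing-tail dec) (pos ∘ suc) p (λ i → ≤-pred (tail<m₀ i))
            (‖x+y‖≤c+d (‖x*l^n‖≤c+n (suc d) ‖x‖≤c) (‖[1+a]*l‖≤1+a b)))
  where
  R = expansion l (a ∘ suc) (m ∘ suc)
  S = sum (tabulate (a ∘ suc))
  value : (x * l ^ suc d + suc b * l) * l ^ p + R ≡ x * l ^ (suc p + d) + (suc b * l ^ suc p + R)
  value = trans (cong (_+ R) (horner-step x l (suc b) p d)) (+-assoc (x * l ^ (suc p + d)) (suc b * l ^ suc p) R)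
  cost : c + suc d + suc b + p + S ≡ c + (suc p + d) + (suc b + S)
  cost = rearrange c d b p S
    where
    rearrange : ∀ c d b p S → c + suc d + suc b + p + S ≡ c + (suc p + d) + (suc b + S)
    rearrange = solve-∀

lemma2p3 : (l k : ℕ) → l > 1 →
    (m a : Fin (suc k) → ℕ) →
    (∀ i j → i <ᶠ j → m j < m i) →
    (∀ i → 1 ≤ m i) →
    (∀ i → a i ≤ l ∸ 1) →
    a zero ≢ 0 →
    ‖ sum (tabulate (λ i → a i * l ^ m i)) ‖ l ≤ (m zero + sum (tabulate a) ∸ 1)
lemma2p3 l k _ m a dec pos _ a₀≢0 with a zero | m zero | pos zero | Decreasing⇒tail<head dec
... | zero  | _     | _  | _       = ⊥-elim (a₀≢0 refl)
... | suc b | zero  | () | _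
... | suc b | suc p | _  | tail<m₀ = ‖‖≤-cong value cost
      (horner-bound (m ∘ suc) (a ∘ suc) (Decreasing-tail dec) (pos ∘ suc) p (λ i → ≤-pred (tail<m₀ i)) (‖[1+a]*l‖≤1+a b))
  where
  R = expansion l (a ∘ suc) (m ∘ suc)
  S = sum (tabulate (a ∘ suc))
  value : suc b * l * l ^ p + R ≡ suc b * l ^ suc p + R
  value = cong (_+ R) (*-assoc (suc b) l (l ^ p))
  cost : suc b + p + S ≡ p + (suc b + S)
  cost = rearrange b p S
    where
    rearrange : ∀ b p S → suc b + p + S ≡ p + (suc b + S)
    rearrange = solve-∀
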